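{- Let $M=(S,S_0,\Delta)$ be the counter system of disjunctive process templates $A,B$ and let $R\subseteq S$ be upward-closed with respect to $\lessapprox_0$. Then $\mathit{opred}(R)$ is upward-closed with respect to $\lessapprox_0$.
   Context: Let $Q_A,Q_B$ be disjoint finite sets, $Q=Q_A\cup Q_B$. A (disjunctive) process template is $U=(Q_U,\mathit{init}_U,\mathcal G_U,\delta_U)$, $U\in\{A,B\}$, with $\mathit{init}_U\in Q_U$, guards $\mathcal G_U\subseteq\mathcal P(Q)$, total $\delta_U\subseteq Q_U\times\mathcal G_U\times Q_U$. Standing assumption: $\delta_B$ contains no transition $(q_i,\{q_i\},q_j)$. Write $Q_B=\{q_0,\dots,q_{|B|-1}\}$, $\vec u_i$ unit vectors. Counter system $M=(S,S_0,\Delta)$: $S=Q_A\times\mathbb N_0^{|B|}$, $S_0=\{(\mathit{init}_A,\vec c)\mid\vec c(q)=0\text{ for }q\ne\mathit{init}_B\}$, and $((q_A,\vec c),(q'_A,\vec c'))\in\Delta$ iff (1) $\vec c'=\vec c$ and some $(q_A,g,q'_A)\in\delta_A$ has some $q_i\in g\cap Q_B$ with $\vec c(i)\ge1$; or (2) $q'_A=q_A$ and some $(q_i,g,q_j)\in\delta_B$ has $\vec c(i)\ge1$, $\vec c'=\vec c-\vec u_i+\vec u_j$, and ($q_A\in g$, or some $q_l\in g\cap Q_B$, $l\neq i$, with $\vec c(l)\ge1$, or $q_i\in g$ and $\vec c(i)\ge2$); such a step of type (2) is said to be based on the local transition $(q_i,g,q_j)$. Order: $(q_A,\vec c)\lessapprox_0(q'_A,\vec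 d)$ iff $q_A=q'_A$, $\vec c\le\vec d$ componentwise, and $\vec c(i)=0\Leftrightarrow\vec d(i)=0$ for all $i$. $\mathit{pred}(R)=\{s\mid\exists r\in R:(s,r)\in\Delta\}$. The set of O-predecessors is $\mathit{opred}(R)=\mathit{pred}(R)\cup\{(q_A,\vec c)\in S\mid\exists(q'_A,\vec c')\in R,\ \exists t=(q_i,g,q_j)\in\delta_B:\ (q'_A,\vec c')$ is reachable from $(q_A,\vec c)$ by a sequence of one or more $\Delta$-steps each based on $t$, and ($\vec c(j)=0$ or $\vec c'(i)=0$)$\}$. A set $X$ is upward-closed w.r.t. $\lessapprox_0$ if $x\in X$ and $x\lessapprox_0 y$ imply $y\in X$. -}

module Defs where

open import Data.Nat using (ℕ; zero; suc; _≤_; pred)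
open import Data.Fin using (Fin)
open import Data.Fin.Subset using (Subset; ⊥; ⁅_⁆) renaming (_∈_ to _∈ₛ_)
open import Data.Vec using (Vec; lookup; updateAt)
open import Data.List using (List)
open import Data.List.Membership.Propositional using (_∈_)
open import Data.Product using (_×_; _,_; ∃; ∃-syntax; Σ-syntax; proj₁; proj₂)
open import Data.Sum using (_⊎_)
open import Relation.Binary.PropositionalEquality using (_≡_; _≢_)
open import Relation.Nullary using (¬_)

-- Q = Q_A ⊎ Q_B with Q_A = Fin nA, Q_B = Fin nB (disjoint by construction).
-- A guard g ⊆ Q is represented by its two parts g ∩ Q_A and g ∩ Q_B.
Guard : ℕ → ℕ → Set
Guard nA nB = Subset nA × Subset nB

record Templates (nA nB : ℕ) : Set where
  field
    initA : Fin nA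
    initB : Fin nB
    δA    : List (Fin nA × Guard nA nB × Fin nA)
    δB    : List (Fin nB × Guard nA nB × Fin nB)

module _ {nA nB : ℕ} (T : Templates nA nB) where
  open Templates T

  Total : Set
  Total = (∀ q → ∃[ g ] ∃[ q' ] ((q , g , q') ∈ δA))
        × (∀ q → ∃[ g ] ∃[ q' ] ((q , g , q') ∈ δB))

  NoSingletonSelfGuard : Set
  NoSingletonSelfGuard = ∀ i g j → (i , g , j) ∈ δB → g ≢ (⊥ , ⁅ i ⁆)

  State : Set
  State = Fin nA × Vec ℕ nB

  S₀ : State → Set
  S₀ (qA , c) = qA ≡ initA × (∀ i → i ≢ initB → lookup c i ≡ 0)

  moveIJ : Fin nB → Fin nB → Vec ℕ nB → Vec ℕ nB
  moveIJ i j c = updateAt (updateAt c i pred) j suc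

  StepB : (Fin nB × Guard nA nB × Fin nB) → State → State → Set
  StepB (i , (gA , gB) , j) (qA , c) (qA' , c') =
      (i , (gA , gB) , j) ∈ δB
    × 1 ≤ lookup c i
    × c' ≡ moveIJ i j c
    × qA' ≡ qA
    × ( qA ∈ₛ gA
      ⊎ (∃[ l ] (l ≢ i × l ∈ₛ gB × 1 ≤ lookup c l))
      ⊎ (i ∈ₛ gB × 2 ≤ lookup c i))

  Step : State → State → Set
  Step (qA , c) (qA' , c') =
      ( c' ≡ c
      × ∃[ gA ] ∃[ gB ] (((qA , (gA , gB) , qA') ∈ δA)
                        × ∃[ i ] (i ∈ₛ gB × 1 ≤ lookup c i)))
    ⊎ ∃[ t ] StepB t (qA , c) (qA' , c')

  data StepsB (t : Fin nB × Guard nA nB × Fin nB) : State → State → Set where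
    one  : ∀ {s s'} → StepB t s s' → StepsB t s s'
    more : ∀ {s s' s''} → StepB t s s' → StepsB t s' s'' → StepsB t s s''

  _⪅₀_ : State → State → Set
  (qA , c) ⪅₀ (qA' , d) =
    qA ≡ qA' × (∀ i → lookup c i ≤ lookup d i)
             × (∀ i → (lookup c i ≡ 0 → lookup d i ≡ 0) × (lookup d i ≡ 0 → lookup c i ≡ 0))

  UpwardClosed : (State → Set) → Set
  UpwardClosed X = ∀ x y → X x → x ⪅₀ y → X y

  pred' : (State → Set) → State → Set
  pred' R s = ∃[ r ] (R r × Step s r)

  opred : (State → Set) → State → Set
  opred R s@(qA , c) =
      pred' R s
    ⊎ ∃[ r ] ∃[ t ] ( R r × t ∈ δB × StepsB t s r
                    × (lookup c (proj₂ (proj₂ t)) ≡ 0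
                       ⊎ lookup (proj₂ r) (proj₁ t) ≡ 0))

{-# OPTIONS --safe #-}
module Submission where

-- Let s ⪅₀ s′. Guards are disjunctive, hence monotone in the counters, so an A-step or a
-- B-step that leaves its source counter positive can be replayed from s′, and the two
-- targets are again ⪅₀-related. A self-loop qᵢ → qᵢ does not change the state at all.
-- What remains is a run of a transition qᵢ → qⱼ with i ≠ j (a single step that empties qᵢ
-- is such a run): from s′ first fire it until the surplus d(i) − c(i) has moved to qⱼ, then
-- replay the run in lockstep. This keeps every empty counter of the original run empty,
-- except qⱼ, which is nonempty after the first step; so the final states are ⪅₀-related
-- and the emptiness side condition of opred carries over.

open import Defs
open import Data.Nat using (ℕ; zero; suc; _≤_; _+_; _∸_; pred; z≤n; s≤s; _≤?_; >-nonZero)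
open import Data.Nat.Properties
  using (≤-trans; ≤-pred; pred-mono-≤; suc-pred; n≤0⇒n≡0; n>0⇒n≢0; 1+n≢0; ≰⇒>; m≤n+m; m≤n⇒m≤1+n; m∸n+n≡m)
open import Data.Fin using (Fin; _≟_)
open import Data.Fin.Subset using () renaming (_∈_ to _∈ₛ_)
open import Data.Vec using (Vec; lookup; updateAt)
open import Data.Vec.Properties
  using (lookup∘updateAt; lookup∘updateAt′; updateAt-updateAt; updateAt-id-local)
open import Data.List.Membership.Propositional using (_∈_)
open import Data.Product using (_×_; _,_; ∃-syntax; proj₁; proj₂)
open import Data.Sum using (_⊎_; inj₁; inj₂)
import Data.Sum as Sum
open import Relation.Binary.Construct.Closure.ReflexiveTransitive using (Star; ε; _◅_)
open import Relation.Binary.PropositionalEquality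
  using (_≡_; _≢_; refl; sym; trans; cong; subst; subst₂)
open import Relation.Nullary using (yes; no; contradiction)

module _ {n : ℕ} where

  _≤ₚ_ : Vec ℕ n → Vec ℕ n → Set
  c ≤ₚ d = ∀ l → lookup c l ≤ lookup d l

  updateAt-mono : ∀ {c d} i {f : ℕ → ℕ} → (∀ {a b} → a ≤ b → f a ≤ f b) →
                  c ≤ₚ d → updateAt c i f ≤ₚ updateAt d i f
  updateAt-mono {c} {d} i {f} f-mono c≤d l with l ≟ i
  ... | yes refl =
    subst₂ _≤_ (sym (lookup∘updateAt i {f} c)) (sym (lookup∘updateAt i {f} d)) (f-mono (c≤d i))
  ... | no l≢i =
    subst₂ _≤_ (sym (lookup∘updateAt′ l i {f} l≢i c)) (sym (lookup∘updateAt′ l i {f} l≢i d)) (c≤d l)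

module _ {nA nB : ℕ} (T : Templates nA nB) where
  open Templates T

  _⪅_ : State T → State T → Set
  _⪅_ = _⪅₀_ T

  ⪅-intro : ∀ {qA c d} → c ≤ₚ d → (∀ l → lookup c l ≡ 0 → lookup d l ≡ 0) → (qA , c) ⪅ (qA , d)
  ⪅-intro c≤d zeros = refl , c≤d , λ l → zeros l , λ z → n≤0⇒n≡0 (subst (_ ≤_) z (c≤d l))

  moveIJ-mono : ∀ {c d} i j → c ≤ₚ d → moveIJ T i j c ≤ₚ moveIJ T i j d
  moveIJ-mono {c} {d} i j c≤d =
    updateAt-mono {c = updateAt c i pred} {updateAt d i pred} j s≤s
      (updateAt-mono {c = c} {d} i pred-mono-≤ c≤d)

  module _ {i j : Fin nB} (c : Vec ℕ nB) where

    lookup-moveIJ-src : i ≢ j → lookup (moveIJ T i j c) i ≡ pred (lookup c i)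
    lookup-moveIJ-src i≢j =
      trans (lookup∘updateAt′ i j {suc} i≢j (updateAt c i pred)) (lookup∘updateAt i {pred} c)

    lookup-moveIJ-dst : i ≢ j → lookup (moveIJ T i j c) j ≡ suc (lookup c j)
    lookup-moveIJ-dst i≢j =
      trans (lookup∘updateAt j {suc} (updateAt c i pred))
            (cong suc (lookup∘updateAt′ j i {pred} (λ j≡i → i≢j (sym j≡i)) c))

    lookup-moveIJ-other : ∀ {l} → l ≢ i → l ≢ j → lookup (moveIJ T i j c) l ≡ lookup c l
    lookup-moveIJ-other {l} l≢i l≢j =
      trans (lookup∘updateAt′ l j {suc} l≢j (updateAt c i pred)) (lookup∘updateAt′ l i {pred} l≢i c)

  moveIJ-self : ∀ {i} c → 1 ≤ lookup c i → moveIJ T i i c ≡ c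
  moveIJ-self {i} c pos =
    trans (updateAt-updateAt i {suc} {pred} c) (updateAt-id-local i c (suc-pred _ {{>-nonZero pos}}))

  Enabled : Fin nA → Guard nA nB → Fin nB → Vec ℕ nB → Set
  Enabled qA (gA , gB) i c =
      qA ∈ₛ gA
    ⊎ (∃[ l ] (l ≢ i × l ∈ₛ gB × 1 ≤ lookup c l))
    ⊎ (i ∈ₛ gB × 2 ≤ lookup c i)

  enabled-mono : ∀ {qA g i c d} → c ≤ₚ d → Enabled qA g i c → Enabled qA g i d
  enabled-mono c≤d (inj₁ qA∈gA) = inj₁ qA∈gA
  enabled-mono c≤d (inj₂ (inj₁ (l , l≢i , l∈gB , pos))) =
    inj₂ (inj₁ (l , l≢i , l∈gB , ≤-trans pos (c≤d l)))
  enabled-mono {i = i} c≤d (inj₂ (inj₂ (i∈gB , pos))) =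
    inj₂ (inj₂ (i∈gB , ≤-trans pos (c≤d i)))

  stepB-from-larger : ∀ {i gA gB j qA c d s} → StepB T (i , (gA , gB) , j) (qA , c) s → c ≤ₚ d →
                      StepB T (i , (gA , gB) , j) (qA , d) (qA , moveIJ T i j d)
  stepB-from-larger {i} {c = c} {d} (t∈δB , pos , _ , _ , en) c≤d =
    t∈δB , ≤-trans pos (c≤d i) , refl , refl , enabled-mono {c = c} {d} c≤d en

  stepsB-first : ∀ {t s r} → StepsB T t s r → ∃[ s₁ ] StepB T t s s₁
  stepsB-first (one st)    = _ , st
  stepsB-first (more st _) = _ , st

  stepsB-prepend : ∀ {t s s' r} → Star (StepB T t) s s' → StepsB T t s' r → StepsB T t s r
  stepsB-prepend ε          run = run
  stepsB-prepend (st ◅ sts) run = more st (stepsB-prepend sts run)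

  stepsB-self-loop : ∀ {i g s r} → StepsB T (i , g , i) s r → r ≡ s
  stepsB-self-loop {g = _ , _} {_ , c} (one (_ , pos , refl , refl , _)) = cong (_ ,_) (moveIJ-self c pos)
  stepsB-self-loop {g = _ , _} {_ , c} (more (_ , pos , refl , refl , _) run) =
    trans (stepsB-self-loop run) (cong (_ ,_) (moveIJ-self c pos))

  record Ahead (i j : Fin nB) (k : ℕ) (e f : Vec ℕ nB) : Set where
    field
      dominates  : e ≤ₚ f
      keeps-zero : ∀ l → l ≢ i → l ≢ j → lookup e l ≡ 0 → lookup f l ≡ 0
      surplus    : lookup f i ≡ k + lookup e i

  ⪅⇒ahead : ∀ {qA i j c d} → (qA , c) ⪅ (qA , d) → Ahead i j (lookup d i ∸ lookup c i) c d
  ⪅⇒ahead {i = i} (_ , c≤d , zeros) = record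
    { dominates  = c≤d
    ; keeps-zero = λ l _ _ → proj₁ (zeros l)
    ; surplus    = sym (m∸n+n≡m (c≤d i))
    }

  ahead-moveIJ : ∀ {i j e f} → i ≢ j → Ahead i j 0 e f → Ahead i j 0 (moveIJ T i j e) (moveIJ T i j f)
  ahead-moveIJ {i} {j} {e} {f} i≢j ah = record
    { dominates  = moveIJ-mono {e} {f} i j dominates
    ; keeps-zero = λ l l≢i l≢j z → trans (lookup-moveIJ-other f l≢i l≢j)
                     (keeps-zero l l≢i l≢j (trans (sym (lookup-moveIJ-other e l≢i l≢j)) z))
    ; surplus    = trans (lookup-moveIJ-src f i≢j)
                     (trans (cong pred surplus) (sym (lookup-moveIJ-src e i≢j)))
    }
    where open Ahead ah

  ahead-drain : ∀ {i j k e f} → i ≢ j → Ahead i j (suc k) e f → Ahead i j k e (moveIJ T i j f)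
  ahead-drain {i} {j} {k} {e} {f} i≢j ah = record
    { dominates  = dominates′
    ; keeps-zero = λ l l≢i l≢j z → trans (lookup-moveIJ-other f l≢i l≢j) (keeps-zero l l≢i l≢j z)
    ; surplus    = surplus′
    }
    where
    open Ahead ah
    surplus′ : lookup (moveIJ T i j f) i ≡ k + lookup e i
    surplus′ = trans (lookup-moveIJ-src f i≢j) (cong pred surplus)
    dominates′ : e ≤ₚ moveIJ T i j f
    dominates′ l with l ≟ i | l ≟ j
    ... | yes refl | _        = subst (lookup e l ≤_) (sym surplus′) (m≤n+m _ k)
    ... | no _     | yes refl =
      subst (lookup e l ≤_) (sym (lookup-moveIJ-dst f i≢j)) (m≤n⇒m≤1+n (dominates l))
    ... | no l≢i   | no l≢j   =
      subst (lookup e l ≤_) (sym (lookup-moveIJ-other f l≢i l≢j)) (dominates l)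

  ahead⇒⪅ : ∀ {qA i j e f} → Ahead i j 0 e f → 1 ≤ lookup e j → (qA , e) ⪅ (qA , f)
  ahead⇒⪅ {i = i} {j} {e} {f} ah ej-pos = ⪅-intro {c = e} {f} dominates keeps-all-zeros
    where
    open Ahead ah
    keeps-all-zeros : ∀ l → lookup e l ≡ 0 → lookup f l ≡ 0
    keeps-all-zeros l z with l ≟ i | l ≟ j
    ... | yes refl | _        = trans surplus z
    ... | no _     | yes refl = contradiction z (n>0⇒n≢0 ej-pos)
    ... | no l≢i   | no l≢j   = keeps-zero l l≢i l≢j z

  stepsB-lockstep : ∀ {i g j qA e f r} → i ≢ j → StepsB T (i , g , j) (qA , e) r → Ahead i j 0 e f →
                    ∃[ r' ] (StepsB T (i , g , j) (qA , f) r' × r ⪅ r')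
  stepsB-lockstep {i} {_ , _} {j} {qA} {e} {f} i≢j (one st@(_ , _ , refl , refl , _)) ah =
    (qA , moveIJ T i j f) , one (stepB-from-larger st (Ahead.dominates ah)) ,
    ahead⇒⪅ (ahead-moveIJ i≢j ah) (subst (1 ≤_) (sym (lookup-moveIJ-dst e i≢j)) (s≤s z≤n))
  stepsB-lockstep {g = _ , _} i≢j (more st@(_ , _ , refl , refl , _) run) ah =
    let r' , run' , r⪅r' = stepsB-lockstep i≢j run (ahead-moveIJ i≢j ah)
    in  r' , more (stepB-from-larger st (Ahead.dominates ah)) run' , r⪅r'

  stepsB-drain : ∀ {i gA gB j qA c s₁} k {f} → i ≢ j → StepB T (i , (gA , gB) , j) (qA , c) s₁ →
                 Ahead i j k c f →
                 ∃[ f' ] (Star (StepB T (i , (gA , gB) , j)) (qA , f) (qA , f') × Ahead i j 0 c f')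
  stepsB-drain zero    i≢j st ah = _ , ε , ah
  stepsB-drain (suc k) i≢j st ah =
    let f' , steps , ah' = stepsB-drain k i≢j st (ahead-drain i≢j ah)
    in  f' , stepB-from-larger st (Ahead.dominates ah) ◅ steps , ah'

  stepsB-simulate : ∀ {i g j s s' r} → i ≢ j → StepsB T (i , g , j) s r → s ⪅ s' →
                    ∃[ r' ] (StepsB T (i , g , j) s' r' × r ⪅ r')
  stepsB-simulate {g = _ , _} {s = _ , _} {_ , _} i≢j run s⪅s'@(refl , _) =
    let _ , first          = stepsB-first run
        _ , drain , ahead  = stepsB-drain _ i≢j first (⪅⇒ahead s⪅s')
        r' , run' , r⪅r'   = stepsB-lockstep i≢j run ahead
    in  r' , stepsB-prepend drain run' , r⪅r'

  stepB-simulate : ∀ {i gA gB j qA c d s₁} → i ≢ j → StepB T (i , (gA , gB) , j) (qA , c) s₁ →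
                   2 ≤ lookup c i → (qA , c) ⪅ (qA , d) → s₁ ⪅ (qA , moveIJ T i j d)
  stepB-simulate {i} {j = j} {c = c} {d} i≢j (_ , _ , refl , refl , _) ci≥2 (_ , c≤d , zeros) =
    ⪅-intro {c = moveIJ T i j c} {moveIJ T i j d} (moveIJ-mono {c} {d} i j c≤d) keeps-zeros
    where
    keeps-zeros : ∀ l → lookup (moveIJ T i j c) l ≡ 0 → lookup (moveIJ T i j d) l ≡ 0
    keeps-zeros l z with l ≟ i | l ≟ j
    ... | yes refl | _        =
      contradiction (trans (sym (lookup-moveIJ-src c i≢j)) z) (n>0⇒n≢0 (pred-mono-≤ ci≥2))
    ... | no _     | yes refl = contradiction (trans (sym (lookup-moveIJ-dst c i≢j)) z) 1+n≢0
    ... | no l≢i   | no l≢j   = trans (lookup-moveIJ-other d l≢i l≢j)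
                                  (proj₁ (zeros l) (trans (sym (lookup-moveIJ-other c l≢i l≢j)) z))

  module _ (R : State T → Set) (R-up : UpwardClosed T R) where

    self-loop-upward : ∀ {i g s s' r} → StepsB T (i , g , i) s r → R r → s ⪅ s' → opred T R s'
    self-loop-upward {g = _ , _} {_ , c} {qA , d} run Rr s⪅s'@(refl , c≤d , _)
      with stepB-from-larger {c = c} {d} (proj₂ (stepsB-first run)) c≤d
    ... | step@(_ , d-pos , _) =
      inj₁ ((qA , d) , R-up _ _ (subst R (stepsB-self-loop run) Rr) s⪅s' ,
            inj₂ (_ , subst (StepB T _ (qA , d)) (cong (qA ,_) (moveIJ-self d d-pos)) step))

    opredB-upward : ∀ {i g j s s' r} → i ≢ j → (i , g , j) ∈ δB → StepsB T (i , g , j) s r → R r →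
                    lookup (proj₂ s) j ≡ 0 ⊎ lookup (proj₂ r) i ≡ 0 → s ⪅ s' → opred T R s'
    opredB-upward {i} {j = j} i≢j t∈δB run Rr drained s⪅s'@(_ , _ , zeros) =
      let r' , run' , r⪅r'@(_ , _ , zeros′) = stepsB-simulate i≢j run s⪅s'
      in  inj₂ (r' , _ , R-up _ _ Rr r⪅r' , t∈δB , run' ,
                Sum.map (proj₁ (zeros j)) (proj₁ (zeros′ i)) drained)

    predB-upward : ∀ {t s s' r} → StepB T t s r → R r → s ⪅ s' → opred T R s'
    predB-upward {i , (_ , _) , j} {_ , c} {_ , d} step@(t∈δB , _ , refl , refl , _) Rr s⪅s'@(refl , c≤d , _)
      with i ≟ j
    ... | yes refl = self-loop-upward (one step) Rr s⪅s'
    ... | no i≢j with 2 ≤? lookup c i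
    ...   | yes ci≥2 =
      inj₁ (_ , R-up _ _ Rr (stepB-simulate {d = d} i≢j step ci≥2 s⪅s') ,
            inj₂ (_ , stepB-from-larger {c = c} {d} step c≤d))
    ...   | no ci≱2 = opredB-upward i≢j t∈δB (one step) Rr (inj₂ source-emptied) s⪅s'
      where
      source-emptied : lookup (moveIJ T i j c) i ≡ 0
      source-emptied = trans (lookup-moveIJ-src c i≢j) (n≤0⇒n≡0 (pred-mono-≤ (≤-pred (≰⇒> ci≱2))))

    pred-upward : ∀ {s s'} → pred' T R s → s ⪅ s' → opred T R s'
    pred-upward (_ , Rr , inj₁ (refl , gA , gB , t∈δA , l , l∈gB , pos)) (refl , c≤d , zeros) =
      inj₁ (_ , R-up _ _ Rr (refl , c≤d , zeros) ,
            inj₁ (refl , gA , gB , t∈δA , l , l∈gB , ≤-trans pos (c≤d l)))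
    pred-upward (_ , Rr , inj₂ (_ , step)) s⪅s' = predB-upward step Rr s⪅s'

lemma4 : ∀ {nA nB} (T : Templates nA nB) → Total T → NoSingletonSelfGuard T →
    (R : State T → Set) → UpwardClosed T R → UpwardClosed T (opred T R)
lemma4 T _ _ R R-up _ _ (inj₁ pred) s⪅s' = pred-upward T R R-up pred s⪅s'
lemma4 T _ _ R R-up _ _ (inj₂ (_ , (i , _ , j) , Rr , t∈δB , run , drained)) s⪅s' with i ≟ j
... | yes refl = self-loop-upward T R R-up run Rr s⪅s'
... | no i≢j   = opredB-upward T R R-up i≢j t∈δB run Rr drained s⪅s'
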